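{- Let $\mathcal{K}$ be a simplicial complex with vertex set $V$, let $f,g:V\to\mathbb{R}$ be arbitrary, and let $h:V\to\mathbb{R}$ be nowhere zero. Then the linear map $\varphi$ defined on each $C_n(\mathcal{K};\mathbb{R})$ by $$\varphi\Big(\sum x_{\{v_0,\dots,v_n\}}\{v_0,\dots,v_n\}\Big)=\sum\frac{x_{\{v_0,\dots,v_n\}}}{h(v_0)h(v_1)\cdots h(v_n)}\{v_0,\dots,v_n\}$$ is a chain isomorphism from $(C_*(\mathcal{K};\mathbb{R}),\partial^f_*)$ to $(C_*(\mathcal{K};\mathbb{R}),\partial^{fh}_*)$ satisfying $\langle\varphi(a),\varphi(b)\rangle_{gh}=\langle a,b\rangle_g$ for all $n$-chains $a,b$.
   Context: $V$ is finite and totally ordered; simplices are written $\{v_0,\dots,v_n\}$ with $v_0\prec\dots\prec v_n$; $C_n(\mathcal{K};\mathbb{R})$ has basis the $n$-simplices. For $F:V\to\mathbb{R}$, $F(\sigma)=\prod_iF(v_i)$; $fh$, $gh$ are pointwise products. $\partial_n^F\{v_0,\dots,v_n\}=\sum_i(-1)^iF(v_i)\{v_0,\dots,\widehat{v_i},\dots,v_n\}$, and $\langle\sigma,\tau\rangle_G=G(\sigma)G(\tau)\delta(\sigma,\tau)$ extended bilinearly. -}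

module Defs where

open import Level using (Level; _⊔_) renaming (suc to lsuc)
open import Data.Nat using (ℕ; zero; suc)
open import Data.Fin using (Fin; toℕ) renaming (_<_ to _<ᶠ_; _≟_ to _≟ᶠ_)
open import Data.Fin.Subset using (Subset; ⁅_⁆; _∪_; _⊆_; Nonempty) renaming (⊥ to ∅)
open import Data.Vec using (Vec; []; _∷_; removeAt; lookup; tabulate; toList)
open import Data.Vec.Properties using (≡-dec)
open import Data.List using (List; []; _∷_; concatMap; map)
open import Data.List.Relation.Unary.All using (All)
open import Data.Product using (_×_; _,_; Σ)
open import Data.Unit using (⊤)
open import Relation.Nullary using (¬_; yes; no)
open import Algebra.Bundles using (CommutativeRing)

-- A (discrete) field: a commutative ring in which every nonzero element
-- has a multiplicative inverse, and 1 ≠ 0.  (Abstract stand-in for ℝ.)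

record Field (c ℓ : Level) : Set (lsuc (c ⊔ ℓ)) where
  field
    commutativeRing : CommutativeRing c ℓ
  open CommutativeRing commutativeRing public
  field
    inv     : (x : Carrier) → ¬ (x ≈ 0#) → Carrier
    inverse : ∀ x (x≉0 : ¬ (x ≈ 0#)) → x * inv x x≉0 ≈ 1#
    1≉0     : ¬ (1# ≈ 0#)

-- Strictly increasing vertex lists: an n-simplex {v₀,…,vₙ}, v₀ ≺ … ≺ vₙ,
-- is represented by the vector (v₀ ∷ … ∷ vₙ ∷ []) of length n+1.
Increasing : ∀ {m k} → Vec (Fin m) k → Set
Increasing []               = ⊤
Increasing (x ∷ [])         = ⊤
Increasing (x ∷ y ∷ xs)     = (x <ᶠ y) × Increasing (y ∷ xs)

toSubset : ∀ {m k} → Vec (Fin m) k → Subset m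
toSubset []       = ∅
toSubset (x ∷ xs) = ⁅ x ⁆ ∪ toSubset xs

record SimplicialComplex (m : ℕ) : Set₁ where
  field
    IsFace      : Subset m → Set
    nonempty    : ∀ s → IsFace s → Nonempty s
    downClosed  : ∀ s t → IsFace t → s ⊆ t → Nonempty s → IsFace s
    singletons  : ∀ v → IsFace ⁅ v ⁆

module Chains {c ℓ} (𝔽 : Field c ℓ) (m : ℕ) where
  open Field 𝔽

  Simplex : ℕ → Set
  Simplex n = Vec (Fin m) (suc n)

  prodV : ∀ {k} → (Fin m → Carrier) → Vec (Fin m) k → Carrier
  prodV F []       = 1#
  prodV F (x ∷ xs) = F x * prodV F xs

  _·_ : (Fin m → Carrier) → (Fin m → Carrier) → (Fin m → Carrier)
  (F · G) v = F v * G v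

  -- An n-chain as a formal finite sum  Σ xⱼ σⱼ  (list of coefficient/simplex pairs).
  Chain : ℕ → Set c
  Chain n = List (Carrier × Simplex n)

  IsChain : SimplicialComplex m → ∀ n → Chain n → Set c
  IsChain K n a = All (λ p → Increasing (Data.Product.proj₂ p)
                               × SimplicialComplex.IsFace K (toSubset (Data.Product.proj₂ p))) a

  sumL : List Carrier → Carrier
  sumL []       = 0#
  sumL (x ∷ xs) = x + sumL xs

  coeff : ∀ {n} → Chain n → Simplex n → Carrier
  coeff []             τ = 0#
  coeff ((x , σ) ∷ a) τ with ≡-dec _≟ᶠ_ σ τ
  ... | yes _ = x + coeff a τ
  ... | no  _ = coeff a τ

  -- equality of chains (as elements of the free module on the simplices)
  _≈ᶜ_ : ∀ {n} → Chain n → Chain n → Set ℓ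
  a ≈ᶜ b = ∀ τ → coeff a τ ≈ coeff b τ

  sign : ℕ → Carrier
  sign zero    = 1#
  sign (suc i) = - sign i

  ∂ : ∀ {n} → (Fin m → Carrier) → Chain (suc n) → Chain n
  ∂ F = concatMap (λ { (x , σ) →
          toList (tabulate (λ i → ((sign (toℕ i) * F (lookup σ i)) * x , removeAt σ i))) })

  δ : ∀ {n} → Simplex n → Simplex n → Carrier
  δ σ τ with ≡-dec _≟ᶠ_ σ τ
  ... | yes _ = 1#
  ... | no  _ = 0#

  ⟨_,_⟩[_] : ∀ {n} → Chain n → Chain n → (Fin m → Carrier) → Carrier
  ⟨ a , b ⟩[ G ] = sumL (concatMap (λ { (x , σ) →
                      map (λ { (y , τ) → (x * y) * ((prodV G σ * prodV G τ) * δ σ τ) }) b }) a)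

  -- φ(Σ x_σ σ) = Σ x_σ / (h(v₀)⋯h(vₙ)) σ,  where 1/(h(v₀)⋯h(vₙ)) = ∏ h(vᵢ)⁻¹
  φ : (h : Fin m → Carrier) → (∀ v → ¬ (h v ≈ 0#)) → ∀ {n} → Chain n → Chain n
  φ h h≉0 = map (λ { (x , σ) → (x * prodV (λ v → inv (h v) (h≉0 v)) σ , σ) })

-- φ multiplies the coefficient of each simplex σ by the unit weight ∏ h(vᵢ)⁻¹, so it is
-- bijective, with inverse the rescaling by ∏ h(vᵢ).  Both compatibilities come from the vertexwise
-- identity F = (F·h)·h⁻¹: deleting vᵢ from σ removes the factor h(vᵢ)⁻¹ from its weight, which turns
-- the factor f(vᵢ) of ∂^f into (fh)(vᵢ); and in ⟨_,_⟩ each weight ∏ h(vᵢ)⁻¹ cancels the extra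
-- factor ∏ h(vᵢ) of (gh)(σ).
module Submission where

open import Defs
open import Data.Nat using (ℕ; suc)
open import Data.Fin using (Fin; toℕ; _≟_) renaming (zero to fzero; suc to fsuc)
open import Data.Vec using (Vec; []; _∷_; removeAt; lookup; tabulate; toList)
open import Data.Vec.Properties using (≡-dec)
open import Data.List using (List; []; _∷_; map; concatMap)
open import Data.List.Properties using (map-++)
open import Data.List.Relation.Binary.Pointwise using (Pointwise; []; _∷_; ++⁺)
import Data.List.Relation.Unary.All.Properties as All
open import Data.Product using (_×_; Σ; _,_)
import Data.Product.Relation.Binary.Pointwise.NonDependent as ×
open import Relation.Nullary using (¬_; yes; no)
open import Relation.Binary.PropositionalEquality using (_≡_; subst) renaming (refl to ≡-refl; sym to ≡-sym)
import Relation.Binary.Reasoning.Setoid as SetoidReasoning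
import Algebra.Solver.CommutativeMonoid as CommutativeMonoidSolver

map-toList-tabulate⁺ : ∀ {a b c r} {A : Set a} {B : Set b} {C : Set c} {R : B → C → Set r} {k}
                       (f : A → B) {t : Fin k → A} {t′ : Fin k → C} →
                       (∀ i → R (f (t i)) (t′ i)) →
                       Pointwise R (map f (toList (tabulate t))) (toList (tabulate t′))
map-toList-tabulate⁺ {k = 0}     f R-ft-t′ = []
map-toList-tabulate⁺ {k = suc k} f R-ft-t′ =
  R-ft-t′ fzero ∷ map-toList-tabulate⁺ f (λ i → R-ft-t′ (fsuc i))

module Rescaling {c ℓ} (𝔽 : Field c ℓ) (m : ℕ) where
  open Field 𝔽
  open Chains 𝔽 m
  open SetoidReasoning setoid
  open CommutativeMonoidSolver *-commutativeMonoid using (solve; _⊜_; _⊕_)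

  prodV-cong : ∀ {k} {F G : Fin m → Carrier} → (∀ v → F v ≈ G v) →
               (σ : Vec (Fin m) k) → prodV F σ ≈ prodV G σ
  prodV-cong F≈G []      = refl
  prodV-cong F≈G (v ∷ σ) = *-cong (F≈G v) (prodV-cong F≈G σ)

  prodV-· : ∀ {k} (F G : Fin m → Carrier) (σ : Vec (Fin m) k) →
            prodV (F · G) σ ≈ prodV F σ * prodV G σ
  prodV-· F G []      = sym (*-identityʳ 1#)
  prodV-· F G (v ∷ σ) = begin
    (F v * G v) * prodV (F · G) σ          ≈⟨ *-cong refl (prodV-· F G σ) ⟩
    (F v * G v) * (prodV F σ * prodV G σ)
      ≈⟨ solve 4 (λ a b c d → (a ⊕ b) ⊕ (c ⊕ d) ⊜ (a ⊕ c) ⊕ (b ⊕ d))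
               refl (F v) (G v) (prodV F σ) (prodV G σ) ⟩
    (F v * prodV F σ) * (G v * prodV G σ)  ∎

  prodV-inverse : ∀ {k} {F G : Fin m → Carrier} → (∀ v → F v * G v ≈ 1#) →
                  (σ : Vec (Fin m) k) → prodV F σ * prodV G σ ≈ 1#
  prodV-inverse {F = F} {G} FG≈1 σ = begin
    prodV F σ * prodV G σ     ≈⟨ sym (prodV-· F G σ) ⟩
    prodV (F · G) σ           ≈⟨ prodV-cong FG≈1 σ ⟩
    prodV (λ _ → 1#) σ        ≈⟨ prodV-one σ ⟩
    1#                        ∎
    where
    prodV-one : ∀ {k} (σ : Vec (Fin m) k) → prodV (λ _ → 1#) σ ≈ 1#
    prodV-one []      = refl
    prodV-one (v ∷ σ) = trans (*-identityˡ _) (prodV-one σ)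

  prodV-removeAt : ∀ {k} (F : Fin m → Carrier) (σ : Vec (Fin m) (suc k)) (i : Fin (suc k)) →
                   prodV F σ ≈ F (lookup σ i) * prodV F (removeAt σ i)
  prodV-removeAt F (v ∷ σ)     fzero    = refl
  prodV-removeAt F (v ∷ w ∷ σ) (fsuc i) = begin
    F v * prodV F (w ∷ σ)                      ≈⟨ *-cong refl (prodV-removeAt F (w ∷ σ) i) ⟩
    F v * (F wᵢ * prodV F (removeAt (w ∷ σ) i))
      ≈⟨ solve 3 (λ a b c → a ⊕ (b ⊕ c) ⊜ b ⊕ (a ⊕ c))
               refl (F v) (F wᵢ) (prodV F (removeAt (w ∷ σ) i)) ⟩
    F wᵢ * (F v * prodV F (removeAt (w ∷ σ) i)) ∎
    where wᵢ = lookup (w ∷ σ) i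

  rescale : ∀ {n} → (Simplex n → Carrier) → Chain n → Chain n
  rescale w = map (λ (x , σ) → (x * w σ , σ))

  rescale-isChain : ∀ K n (w : Simplex n → Carrier) {a : Chain n} →
                    IsChain K n a → IsChain K n (rescale w a)
  rescale-isChain K n w = All.map⁺

  coeff-rescale : ∀ {n} (w : Simplex n → Carrier) (a : Chain n) τ →
                  coeff (rescale w a) τ ≈ w τ * coeff a τ
  coeff-rescale w []            τ = sym (zeroʳ (w τ))
  coeff-rescale w ((x , σ) ∷ a) τ with ≡-dec _≟_ σ τ
  ... | yes ≡-refl = begin
    x * w σ + coeff (rescale w a) σ  ≈⟨ +-cong (*-comm x (w σ)) (coeff-rescale w a σ) ⟩
    w σ * x + w σ * coeff a σ        ≈⟨ sym (distribˡ (w σ) x (coeff a σ)) ⟩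
    w σ * (x + coeff a σ)            ∎
  ... | no _ = coeff-rescale w a τ

  rescale-cong : ∀ {n} (w : Simplex n → Carrier) {a b : Chain n} →
                 a ≈ᶜ b → rescale w a ≈ᶜ rescale w b
  rescale-cong w {a} {b} a≈b τ = begin
    coeff (rescale w a) τ  ≈⟨ coeff-rescale w a τ ⟩
    w τ * coeff a τ        ≈⟨ *-cong refl (a≈b τ) ⟩
    w τ * coeff b τ        ≈⟨ coeff-rescale w b τ ⟨
    coeff (rescale w b) τ  ∎

  rescale-inverse : ∀ {n} {w w′ : Simplex n → Carrier} → (∀ τ → w′ τ * w τ ≈ 1#) →
                    (a : Chain n) → rescale w′ (rescale w a) ≈ᶜ a
  rescale-inverse {w = w} {w′} w′w≈1 a τ = begin
    coeff (rescale w′ (rescale w a)) τ  ≈⟨ coeff-rescale w′ (rescale w a) τ ⟩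
    w′ τ * coeff (rescale w a) τ        ≈⟨ *-cong refl (coeff-rescale w a τ) ⟩
    w′ τ * (w τ * coeff a τ)            ≈⟨ *-assoc (w′ τ) (w τ) (coeff a τ) ⟨
    (w′ τ * w τ) * coeff a τ            ≈⟨ *-cong (w′w≈1 τ) refl ⟩
    1# * coeff a τ                      ≈⟨ *-identityˡ (coeff a τ) ⟩
    coeff a τ                           ∎

  rescale-injective : ∀ {n} {w w′ : Simplex n → Carrier} → (∀ τ → w′ τ * w τ ≈ 1#) →
                      {a b : Chain n} → rescale w a ≈ᶜ rescale w b → a ≈ᶜ b
  rescale-injective {w = w} {w′} w′w≈1 {a} {b} wa≈wb τ = begin
    coeff a τ                           ≈⟨ rescale-inverse w′w≈1 a τ ⟨
    coeff (rescale w′ (rescale w a)) τ  ≈⟨ rescale-cong w′ {rescale w a} {rescale w b} wa≈wb τ ⟩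
    coeff (rescale w′ (rescale w b)) τ  ≈⟨ rescale-inverse w′w≈1 b τ ⟩
    coeff b τ                           ∎

  _≈ₜ_ : ∀ {n} → Carrier × Simplex n → Carrier × Simplex n → Set ℓ
  _≈ₜ_ = ×.Pointwise _≈_ _≡_

  coeff-cong : ∀ {n} {a b : Chain n} → Pointwise _≈ₜ_ a b → a ≈ᶜ b
  coeff-cong []                                          τ = refl
  coeff-cong {a = (x , σ) ∷ a} ((x≈y , ≡-refl) ∷ a≈b) τ with ≡-dec _≟_ σ τ
  ... | yes _ = +-cong x≈y (coeff-cong a≈b τ)
  ... | no  _ = coeff-cong a≈b τ

  -- Removing the vertex vᵢ divides the weight ∏ u of the simplex by exactly u(vᵢ).
  rescale-∂ : ∀ {n} {F G u : Fin m → Carrier} → (∀ v → F v ≈ G v * u v) →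
              (a : Chain (suc n)) → rescale (prodV u) (∂ F a) ≈ᶜ ∂ G (rescale (prodV u) a)
  rescale-∂ {n} {F} {G} {u} F≈Gu a = coeff-cong (termwise a)
    where
    face : ∀ x (σ : Simplex (suc n)) i →
           ((sign (toℕ i) * F (lookup σ i)) * x) * prodV u (removeAt σ i)
             ≈ (sign (toℕ i) * G (lookup σ i)) * (x * prodV u σ)
    face x σ i = begin
      ((s * F vᵢ) * x) * uσᵢ                  ≈⟨ *-cong (*-cong (*-cong refl (F≈Gu vᵢ)) refl) refl ⟩
      ((s * (G vᵢ * u vᵢ)) * x) * uσᵢ
        ≈⟨ solve 5 (λ s g u x r → ((s ⊕ (g ⊕ u)) ⊕ x) ⊕ r ⊜ (s ⊕ g) ⊕ (x ⊕ (u ⊕ r)))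
                 refl s (G vᵢ) (u vᵢ) x uσᵢ ⟩
      (s * G vᵢ) * (x * (u vᵢ * uσᵢ))         ≈⟨ *-cong refl (*-cong refl (prodV-removeAt u σ i)) ⟨
      (s * G vᵢ) * (x * prodV u σ)            ∎
      where
      s   = sign (toℕ i)
      vᵢ  = lookup σ i
      uσᵢ = prodV u (removeAt σ i)

    termwise : ∀ a → Pointwise _≈ₜ_ (rescale (prodV u) (∂ F a)) (∂ G (rescale (prodV u) a))
    termwise []            = []
    termwise ((x , σ) ∷ a) =
      subst (λ l → Pointwise _≈ₜ_ l (∂ G (rescale (prodV u) ((x , σ) ∷ a))))
            (≡-sym (map-++ _ _ (∂ F a)))
            (++⁺ (map-toList-tabulate⁺ _ {t = λ i → (sign (toℕ i) * F (lookup σ i)) * x , removeAt σ i}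
                                        (λ i → face x σ i , ≡-refl))
                  (termwise a))

  pairing : ∀ {n} → (Fin m → Carrier) → Carrier × Simplex n → Carrier × Simplex n → Carrier
  pairing G (x , σ) (y , τ) = (x * y) * ((prodV G σ * prodV G τ) * δ σ τ)

  sumL-cong : ∀ {xs ys : List Carrier} → Pointwise _≈_ xs ys → sumL xs ≈ sumL ys
  sumL-cong []            = refl
  sumL-cong (x≈y ∷ xs≈ys) = +-cong x≈y (sumL-cong xs≈ys)

  ⟨⟩-rescale : ∀ {n} {F G u : Fin m → Carrier} → (∀ v → F v ≈ G v * u v) →
               (a b : Chain n) → ⟨ rescale (prodV u) a , rescale (prodV u) b ⟩[ G ] ≈ ⟨ a , b ⟩[ F ]
  ⟨⟩-rescale {n} {F} {G} {u} F≈Gu a b = sumL-cong (pairings a)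
    where
    prodV-F : ∀ σ → prodV F σ ≈ prodV G σ * prodV u σ
    prodV-F σ = trans (prodV-cong F≈Gu σ) (prodV-· G u σ)

    pairing-rescale : ∀ x y (σ τ : Simplex n) →
                      pairing G (x * prodV u σ , σ) (y * prodV u τ , τ) ≈ pairing F (x , σ) (y , τ)
    pairing-rescale x y σ τ = begin
      (x * prodV u σ * (y * prodV u τ)) * ((prodV G σ * prodV G τ) * δ σ τ)
        ≈⟨ solve 7 (λ x uσ y uτ gσ gτ d →
                     ((x ⊕ uσ) ⊕ (y ⊕ uτ)) ⊕ ((gσ ⊕ gτ) ⊕ d) ⊜ (x ⊕ y) ⊕ (((gσ ⊕ uσ) ⊕ (gτ ⊕ uτ)) ⊕ d))
                 refl x (prodV u σ) y (prodV u τ) (prodV G σ) (prodV G τ) (δ σ τ) ⟩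
      (x * y) * (((prodV G σ * prodV u σ) * (prodV G τ * prodV u τ)) * δ σ τ)
        ≈⟨ *-cong refl (*-cong (*-cong (prodV-F σ) (prodV-F τ)) refl) ⟨
      (x * y) * ((prodV F σ * prodV F τ) * δ σ τ) ∎

    row : ∀ x σ (b : Chain n) →
          Pointwise _≈_ (map (pairing G (x * prodV u σ , σ)) (rescale (prodV u) b))
                        (map (pairing F (x , σ)) b)
    row x σ []            = []
    row x σ ((y , τ) ∷ b) = pairing-rescale x y σ τ ∷ row x σ b

    pairings : ∀ a → Pointwise _≈_
      (concatMap (λ p → map (pairing G p) (rescale (prodV u) b)) (rescale (prodV u) a))
      (concatMap (λ p → map (pairing F p) b) a)
    pairings []            = []
    pairings ((x , σ) ∷ a) = ++⁺ (row x σ b) (pairings a)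

lemma3p7 : ∀ {c ℓ} (𝔽 : Field c ℓ) (m : ℕ) (K : SimplicialComplex m)
           (f g h : Fin m → Field.Carrier 𝔽)
           (h≉0 : ∀ v → ¬ (Field._≈_ 𝔽 (h v) (Field.0# 𝔽))) →
           let open Field 𝔽 in let open Chains 𝔽 m in
           (∀ n (a : Chain n) → IsChain K n a → IsChain K n (φ h h≉0 a))
           × (∀ n (a b : Chain n) → IsChain K n a → IsChain K n b →
                a ≈ᶜ b → φ h h≉0 a ≈ᶜ φ h h≉0 b)
           × (∀ n (a : Chain (suc n)) → IsChain K (suc n) a →
                φ h h≉0 (∂ f a) ≈ᶜ ∂ (f · h) (φ h h≉0 a))
           × (∀ n (a b : Chain n) → IsChain K n a → IsChain K n b →
                φ h h≉0 a ≈ᶜ φ h h≉0 b → a ≈ᶜ b)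
           × (∀ n (b : Chain n) → IsChain K n b →
                Σ (Chain n) (λ a → IsChain K n a × (φ h h≉0 a ≈ᶜ b)))
           × (∀ n (a b : Chain n) → IsChain K n a → IsChain K n b →
                ⟨ φ h h≉0 a , φ h h≉0 b ⟩[ g · h ] ≈ ⟨ a , b ⟩[ g ])
lemma3p7 𝔽 m K f g h h≉0 =
    (λ n a → rescale-isChain K n (prodV h⁻¹))
  , (λ n a b _ _ → rescale-cong (prodV h⁻¹) {a} {b})
  , (λ n a _ → rescale-∂ (undo-h f) a)
  , (λ n a b _ _ → rescale-injective (prodV-inverse h·h⁻¹≈1) {a} {b})
  , (λ n b b∈K → rescale (prodV h) b , rescale-isChain K n (prodV h) b∈K
                                      , rescale-inverse (prodV-inverse h⁻¹·h≈1) b)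
  , (λ n a b _ _ → ⟨⟩-rescale (undo-h g) a b)
  where
  open Field 𝔽
  open Chains 𝔽 m
  open Rescaling 𝔽 m

  -- φ h h≉0 is definitionally  rescale (prodV h⁻¹).
  h⁻¹ : Fin m → Carrier
  h⁻¹ v = inv (h v) (h≉0 v)

  h·h⁻¹≈1 : ∀ v → h v * h⁻¹ v ≈ 1#
  h·h⁻¹≈1 v = inverse (h v) (h≉0 v)

  h⁻¹·h≈1 : ∀ v → h⁻¹ v * h v ≈ 1#
  h⁻¹·h≈1 v = trans (*-comm (h⁻¹ v) (h v)) (h·h⁻¹≈1 v)

  undo-h : ∀ (F : Fin m → Carrier) v → F v ≈ (F · h) v * h⁻¹ v
  undo-h F v = sym (trans (*-assoc (F v) (h v) (h⁻¹ v))
                          (trans (*-cong refl (h·h⁻¹≈1 v)) (*-identityʳ (F v))))
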